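{- Let $a\in\{p_1,\dotsc,p_n\}$ and let $x$ be a feasible solution of mod-IP($a$). Run the procedure described in the context starting from $x$. Let $z$ be the current assignment at any moment during Phase III before all removed jobs have been assigned back. Then there is a big machine $i\in B$ with $\sum_j p_jz_{ij}\le T_i-a$. In particular, a job with processing time $a$ can be added to $i$ without its load exceeding $T_i$.
   Context: A Multiway Partitioning instance consists of integers $n\ge m\ge1$, $p_1,\dotsc,p_n\in\mathbb{N}$ and $T_1,\dotsc,T_m\in\mathbb{N}$ with $p_1+\cdots+p_n=T_1+\cdots+T_m$ (jobs $j$ with processing times $p_j$, machines $i$ with targets $T_i$). Let $p_{\max}=\max_j p_j$. A machine $i$ is small if $T_i<p_{\max}^4$ and big otherwise; $S$ is the set of small machines and $B=\{1,\dotsc,m\}\setminus S$. For $a\in\{p_1,\dotsc,p_n\}$, mod-IP($a$) is the system in binary variables $x_{ij}\in\{0,1\}$ ($i=1,\dotsc,m$, $j=1,\dotsc,n$): $\sum_j p_jx_{ij}=T_i$ for all $i\in S$; $\sum_j p_jx_{ij}\equiv T_i \pmod a$ for all $i\in B$; $\sum_{j:p_j=a}\sum_{i\in B}x_{ij}\ge p_{\max}^2|B|$; $\sum_{i=1}^m x_{ij}=1$ for all $j$. A 0/1 assignment $z$ (each job assigned to at most one machine) gives machine $i$ load $\sum_j p_jz_{ij}$. The procedure: Phase I: starting from the assignment $x$, remove (make unassigned) every job of processing time $a$ assigned to a big machine; then, as long as there are a big machine $i$ and a value $b\neq a$ such that at least $a$ jobs of processing time $b$ are assigned to $i$, remove $a$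 of these jobs from $i$ together; such a removed group of $a$ jobs is called a bundle. Phase II: the bundles are reassigned one at a time, each bundle's jobs all to a single big machine $i$ whose load after adding the bundle does not exceed $T_i$. Phase III: then the removed jobs of processing time $a$ are reassigned one at a time, each to a big machine $i$ whose load after adding it does not exceed $T_i$. -}

module Defs where

open import Data.Nat using (ℕ; zero; suc; _+_; _*_; _^_; _≤_; _<_; _⊔_; ∣_-_∣; _≤?_)
open import Data.Nat.Divisibility using (_∣_)
open import Data.Fin using (Fin; zero; suc)
import Data.Fin as F
import Data.Nat as N
open import Data.Bool using (Bool; true; false; if_then_else_; _∧_; _∨_)
open import Data.List using (List; []; _∷_; length)
open import Data.List.Relation.Unary.All using (All)
open import Data.List.Relation.Unary.Unique.Propositional using (Unique)
open import Data.List.Membership.Propositional using (_∈_)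
open import Data.Product using (Σ; _×_; ∃)
open import Relation.Nullary using (¬_)
open import Relation.Nullary.Decidable using (⌊_⌋)
open import Relation.Binary.PropositionalEquality using (_≡_; _≢_)

∑ : (n : ℕ) → (Fin n → ℕ) → ℕ
∑ zero    f = 0
∑ (suc n) f = f zero + ∑ n (λ j → f (suc j))

maxF : (n : ℕ) → (Fin n → ℕ) → ℕ
maxF zero    f = 0
maxF (suc n) f = f zero ⊔ maxF n (λ j → f (suc j))

_∈ᵇ_ : {n : ℕ} → Fin n → List (Fin n) → Bool
j ∈ᵇ []       = false
j ∈ᵇ (k ∷ ks) = ⌊ j F.≟ k ⌋ ∨ (j ∈ᵇ ks)

-- An assignment matrix: z i j ∈ {0,1} says whether job j is on machine i.
Asg : ℕ → ℕ → Set
Asg n m = Fin m → Fin n → ℕ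

Bundle : ℕ → Set
Bundle n = List (Fin n)

module Inst {n m : ℕ} (p : Fin n → ℕ) (T : Fin m → ℕ) (a : ℕ) where

  pmax : ℕ
  pmax = maxF n p

  Big : Fin m → Set
  Big i = pmax ^ 4 ≤ T i

  Small : Fin m → Set
  Small i = T i < pmax ^ 4

  big? : Fin m → Bool
  big? i = ⌊ pmax ^ 4 ≤? T i ⌋

  numBig : ℕ
  numBig = ∑ m (λ i → if big? i then 1 else 0)

  load : Asg n m → Fin m → ℕ
  load z i = ∑ n (λ j → p j * z i j)

  count : Asg n m → Fin m → ℕ → ℕ
  count z i b = ∑ n (λ j → if ⌊ p j N.≟ b ⌋ then z i j else 0)

  -- congruence u ≡ v (mod a)  (for a = 0 this is equality)
  _≡[mod]_ : ℕ → ℕ → Set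
  u ≡[mod] v = a ∣ ∣ u - v ∣

  ModIPFeasible : Asg n m → Set
  ModIPFeasible x =
      (∀ i j → x i j ≤ 1)
    × (∀ i → Small i → load x i ≡ T i)
    × (∀ i → Big i → load x i ≡[mod] T i)
    × (pmax ^ 2 * numBig ≤ ∑ n (λ j → if ⌊ p j N.≟ a ⌋ then ∑ m (λ i → if big? i then x i j else 0) else 0))
    × (∀ j → ∑ m (λ i → x i j) ≡ 1)

  initRemove : Asg n m → Asg n m
  initRemove x i j = if big? i ∧ ⌊ p j N.≟ a ⌋ then 0 else x i j

  BundleStep : Asg n m → Bundle n → Asg n m → Set
  BundleStep z js z' = Σ (Fin m) λ i → Σ ℕ λ b →
      Big i × b ≢ a × length js ≡ a × Unique js
    × All (λ j → p j ≡ b × z i j ≡ 1) js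
    × (∀ i' j' → z' i' j' ≡ (if ⌊ i' F.≟ i ⌋ ∧ (j' ∈ᵇ js) then 0 else z i' j'))

  data BundleLoop : Asg n m → List (Bundle n) → Asg n m → Set where
    stop : ∀ {z} → BundleLoop z [] z
    step : ∀ {z z' z'' js bs} → BundleStep z js z' → BundleLoop z' bs z'' →
           BundleLoop z (js ∷ bs) z''

  LoopDone : Asg n m → Set
  LoopDone z = ∀ i → Big i → ∀ b → b ≢ a → count z i b < a

  PhaseI : Asg n m → List (Bundle n) → Asg n m → Set
  PhaseI x bs z = BundleLoop (initRemove x) bs z × LoopDone z

  AddBundle : Asg n m → Fin m → Bundle n → Asg n m → Set
  AddBundle z i js z' =
    ∀ i' j' → z' i' j' ≡ (if ⌊ i' F.≟ i ⌋ ∧ (j' ∈ᵇ js) then 1 else z i' j')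

  data PhaseII : Asg n m → List (Bundle n) → Asg n m → Set where
    stop : ∀ {z} → PhaseII z [] z
    step : ∀ {z z' z'' js bs} (i : Fin m) → Big i → AddBundle z i js z' →
           load z' i ≤ T i → PhaseII z' bs z'' → PhaseII z (js ∷ bs) z''

  RemovedA : Asg n m → Fin n → Set
  RemovedA x j = p j ≡ a × Σ (Fin m) λ i → Big i × x i j ≡ 1

  AddJob : Asg n m → Fin m → Fin n → Asg n m → Set
  AddJob z i j z' =
    ∀ i' j' → z' i' j' ≡ (if ⌊ i' F.≟ i ⌋ ∧ ⌊ j' F.≟ j ⌋ then 1 else z i' j')

  data PhaseIII (x : Asg n m) : Asg n m → List (Fin n) → Asg n m → Set where
    start : ∀ {z} → PhaseIII x z [] z
    step  : ∀ {z z' z'' done} (j : Fin n) (i : Fin m) → PhaseIII x z done z' →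
            RemovedA x j → ¬ (j ∈ done) → Big i → AddJob z' i j z'' →
            load z'' i ≤ T i → PhaseIII x z (j ∷ done) z''

-- Throughout the procedure every small machine keeps load exactly T_i and every
-- big machine keeps load ≡ T_i (mod a): x satisfies this, and each removal or reassignment on a
-- big machine moves a multiple of a (the jobs of time a, a bundle of a equal jobs, or one job of
-- time a). Moreover every job sits on at most one machine, and a removed job of time a that is
-- still unassigned sits on none, so the total load is at most ∑ p − a = ∑ T − a. If no big
-- machine had load ≤ T_i − a, the congruence would force load ≥ T_i on every big machine, and the
-- total load would be at least ∑ T.

module Submission where

open import Data.Bool using (Bool; true; false; if_then_else_; _∧_)
open import Data.Bool.Properties using (∧-identityʳ; ∧-zeroʳ)
open import Data.Empty using (⊥-elim)
open import Data.Fin using (Fin; zero; suc)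
import Data.Fin as F
open import Data.Fin.Properties using (any?)
open import Data.List using (List; []; _∷_; length; map)
open import Data.List.Membership.Propositional using (_∈_)
open import Data.List.Relation.Binary.Permutation.Propositional using (_↭_; ↭-sym)
open import Data.List.Relation.Binary.Permutation.Propositional.Properties using (map⁺; All-resp-↭)
open import Data.List.Relation.Unary.All using (All; []; _∷_) renaming (lookup to All-lookup)
open import Data.List.Relation.Unary.All.Properties using (All¬⇒¬Any)
open import Data.List.Relation.Unary.AllPairs using (_∷_)
open import Data.List.Relation.Unary.Any using (here; there)
open import Data.List.Relation.Unary.Unique.Propositional using (Unique)
open import Data.Nat using (ℕ; zero; suc; _+_; _*_; _∸_; _^_; _≤_; _<_; _≥_; _≤?_; z≤n; s≤s; ∣_-_∣)
import Data.Nat as N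
open import Data.Nat.Divisibility using (_∣_; divides; _∣0; m∣m*n)
open import Data.Nat.ListAction using (sum)
open import Data.Nat.ListAction.Properties using (sum-↭)
open import Data.Nat.Properties
open import Data.Product using (Σ; ∃₂; _×_; _,_; proj₁; proj₂)
open import Data.Sum using (inj₁; inj₂)
open import Function.Bundles using (_⇔_; mk⇔; Equivalence)
open import Relation.Binary.PropositionalEquality
  using (_≡_; _≢_; refl; sym; trans; cong; cong₂; subst; module ≡-Reasoning)
open import Relation.Nullary using (¬_; yes; no)
open import Relation.Nullary.Decidable using (⌊_⌋; _×-dec_)

open import Defs

import Algebra.Properties.Semiring.Sum +-*-semiring as VecSum
open import Algebra.Properties.CommutativeSemigroup +-commutativeSemigroup using (xy∙z≈xz∙y; x∙yz≈yx∙z)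
⟦_⟧ : Bool → ℕ
⟦ true ⟧  = 1
⟦ false ⟧ = 0

∑≡sum : ∀ n (f : Fin n → ℕ) → ∑ n f ≡ VecSum.sum f
∑≡sum zero    f = refl
∑≡sum (suc n) f = cong (f zero +_) (∑≡sum n (λ j → f (suc j)))

∑-cong : ∀ n {f g : Fin n → ℕ} → (∀ j → f j ≡ g j) → ∑ n f ≡ ∑ n g
∑-cong n {f} {g} f≗g = trans (∑≡sum n f) (trans (VecSum.sum-cong-≗ f≗g) (sym (∑≡sum n g)))

∑-zero : ∀ n → ∑ n (λ _ → 0) ≡ 0
∑-zero n = trans (∑≡sum n _) (VecSum.sum-replicate-zero n)

∑-distrib-+ : ∀ n (f g : Fin n → ℕ) → ∑ n (λ j → f j + g j) ≡ ∑ n f + ∑ n g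
∑-distrib-+ n f g = begin
  ∑ n (λ j → f j + g j)          ≡⟨ ∑≡sum n _ ⟩
  VecSum.sum (λ j → f j + g j)   ≡⟨ VecSum.∑-distrib-+ f g ⟩
  VecSum.sum f + VecSum.sum g    ≡⟨ sym (cong₂ _+_ (∑≡sum n f) (∑≡sum n g)) ⟩
  ∑ n f + ∑ n g                  ∎
  where open ≡-Reasoning

*-distribˡ-∑ : ∀ n c (f : Fin n → ℕ) → c * ∑ n f ≡ ∑ n (λ j → c * f j)
*-distribˡ-∑ n c f = begin
  c * ∑ n f                    ≡⟨ cong (c *_) (∑≡sum n f) ⟩
  c * VecSum.sum f             ≡⟨ VecSum.*-distribˡ-sum c f ⟩
  VecSum.sum (λ j → c * f j)   ≡⟨ sym (∑≡sum n _) ⟩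
  ∑ n (λ j → c * f j)          ∎
  where open ≡-Reasoning

∑-comm : ∀ m n (f : Fin m → Fin n → ℕ) →
         ∑ m (λ i → ∑ n (f i)) ≡ ∑ n (λ j → ∑ m (λ i → f i j))
∑-comm m n f = begin
  ∑ m (λ i → ∑ n (f i))                        ≡⟨ ∑-cong m (λ i → ∑≡sum n (f i)) ⟩
  ∑ m (λ i → VecSum.sum (f i))                 ≡⟨ ∑≡sum m _ ⟩
  VecSum.sum (λ i → VecSum.sum (f i))          ≡⟨ VecSum.∑-comm f ⟩
  VecSum.sum (λ j → VecSum.sum (λ i → f i j))  ≡⟨ sym (∑≡sum n _) ⟩
  ∑ n (λ j → VecSum.sum (λ i → f i j))         ≡⟨ ∑-cong n (λ j → sym (∑≡sum m _)) ⟩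
  ∑ n (λ j → ∑ m (λ i → f i j))                ∎
  where open ≡-Reasoning

≤-∑ : ∀ n (f : Fin n → ℕ) k → f k ≤ ∑ n f
≤-∑ (suc n) f zero    = m≤m+n _ _
≤-∑ (suc n) f (suc k) = ≤-trans (≤-∑ n (λ j → f (suc j)) k) (m≤n+m _ _)

∑-mono-≤ : ∀ n {f g : Fin n → ℕ} → (∀ j → f j ≤ g j) → ∑ n f ≤ ∑ n g
∑-mono-≤ zero    f≤g = z≤n
∑-mono-≤ (suc n) f≤g = +-mono-≤ (f≤g zero) (∑-mono-≤ n (λ j → f≤g (suc j)))

∑-mono-≤-slack : ∀ n {f g : Fin n → ℕ} k d → (∀ j → f j ≤ g j) → f k + d ≤ g k →
                 ∑ n f + d ≤ ∑ n g
∑-mono-≤-slack (suc n) {f} {g} zero d f≤g slack = begin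
  f zero + ∑ n (λ j → f (suc j)) + d   ≡⟨ xy∙z≈xz∙y (f zero) _ d ⟩
  f zero + d + ∑ n (λ j → f (suc j))   ≤⟨ +-mono-≤ slack (∑-mono-≤ n (λ j → f≤g (suc j))) ⟩
  g zero + ∑ n (λ j → g (suc j))       ∎
  where open ≤-Reasoning
∑-mono-≤-slack (suc n) {f} {g} (suc k) d f≤g slack = begin
  f zero + ∑ n (λ j → f (suc j)) + d   ≡⟨ +-assoc (f zero) _ d ⟩
  f zero + (∑ n (λ j → f (suc j)) + d) ≤⟨ +-mono-≤ (f≤g zero) (∑-mono-≤-slack n k d (λ j → f≤g (suc j)) slack) ⟩
  g zero + ∑ n (λ j → g (suc j))       ∎
  where open ≤-Reasoning

∑-pick : ∀ n (f : Fin n → ℕ) k → ∑ n (λ j → f j * ⟦ ⌊ j F.≟ k ⌋ ⟧) ≡ f k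
∑-pick (suc n) f zero = begin
  f zero * 1 + ∑ n (λ j → f (suc j) * 0)
    ≡⟨ cong₂ _+_ (*-identityʳ (f zero)) (∑-cong n (λ j → *-zeroʳ (f (suc j)))) ⟩
  f zero + ∑ n (λ _ → 0)                   ≡⟨ cong (f zero +_) (∑-zero n) ⟩
  f zero + 0                               ≡⟨ +-identityʳ (f zero) ⟩
  f zero                                   ∎
  where open ≡-Reasoning
∑-pick (suc n) f (suc k) = begin
  f zero * 0 + ∑ n (λ j → f (suc j) * ⟦ ⌊ suc j F.≟ suc k ⌋ ⟧)
    ≡⟨ cong₂ _+_ (*-zeroʳ (f zero)) (∑-cong n (λ j → cong (λ b → f (suc j) * ⟦ b ⟧) (suc-≟-suc j k))) ⟩
  ∑ n (λ j → f (suc j) * ⟦ ⌊ j F.≟ k ⌋ ⟧)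
    ≡⟨ ∑-pick n (λ j → f (suc j)) k ⟩
  f (suc k)
    ∎
  where
  open ≡-Reasoning
  suc-≟-suc : ∀ {n} (j k : Fin n) → ⌊ suc j F.≟ suc k ⌋ ≡ ⌊ j F.≟ k ⌋
  suc-≟-suc j k with j F.≟ k
  ... | yes refl = refl
  ... | no _     = refl

∑-indicator : ∀ n (k : Fin n) → ∑ n (λ j → ⟦ ⌊ j F.≟ k ⌋ ⟧) ≡ 1
∑-indicator n k = trans (∑-cong n (λ j → sym (*-identityˡ _))) (∑-pick n (λ _ → 1) k)

infix 4 _≈_mod_

-- u ≡ v (mod a), stated without subtraction so that it is closed under adding multiples of a
_≈_mod_ : ℕ → ℕ → ℕ → Set
u ≈ v mod a = ∃₂ λ k l → u + k * a ≡ v + l * a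

∣∣-∣⇒≈mod : ∀ {a} u v → a ∣ ∣ u - v ∣ → u ≈ v mod a
∣∣-∣⇒≈mod u v (divides q eq) with ≤-total u v
... | inj₁ u≤v = q , 0 , (begin
  u + q * _            ≡⟨ cong (u +_) (sym (trans (sym (m≤n⇒∣m-n∣≡n∸m u≤v)) eq)) ⟩
  u + (v ∸ u)          ≡⟨ m+[n∸m]≡n u≤v ⟩
  v                    ≡⟨ sym (+-identityʳ v) ⟩
  v + 0                ∎)
  where open ≡-Reasoning
... | inj₂ v≤u = 0 , q , (begin
  u + 0                ≡⟨ +-identityʳ u ⟩
  u                    ≡⟨ sym (m+[n∸m]≡n v≤u) ⟩
  v + (u ∸ v)          ≡⟨ cong (v +_) (trans (sym (m≤n⇒∣n-m∣≡n∸m v≤u)) eq) ⟩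
  v + q * _            ∎)
  where open ≡-Reasoning

≈mod-+ : ∀ {a u v d} → u ≈ v mod a → a ∣ d → u + d ≈ v mod a
≈mod-+ {a} {u} {v} (k , l , eq) (divides q refl) = k , l + q , (begin
  u + q * a + k * a   ≡⟨ xy∙z≈xz∙y u (q * a) (k * a) ⟩
  u + k * a + q * a   ≡⟨ cong (_+ q * a) eq ⟩
  v + l * a + q * a   ≡⟨ +-assoc v (l * a) (q * a) ⟩
  v + (l * a + q * a) ≡⟨ cong (v +_) (sym (*-distribʳ-+ a l q)) ⟩
  v + (l + q) * a     ∎)
  where open ≡-Reasoning

≈mod-cancel-+ : ∀ {a u v d} → u + d ≈ v mod a → a ∣ d → u ≈ v mod a
≈mod-cancel-+ {a} {u} {v} (k , l , eq) (divides q refl) = q + k , l , (begin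
  u + (q + k) * a     ≡⟨ cong (u +_) (*-distribʳ-+ a q k) ⟩
  u + (q * a + k * a) ≡⟨ sym (+-assoc u (q * a) (k * a)) ⟩
  u + q * a + k * a   ≡⟨ eq ⟩
  v + l * a           ∎)
  where open ≡-Reasoning

≈mod⇒≤ : ∀ {a u v} → u ≈ v mod a → v < u + a → v ≤ u
≈mod⇒≤ {a} {u} {v} (k , l , eq) v<u+a with k ≤? l
... | yes k≤l = +-cancelʳ-≤ (l * a) v u (begin
  v + l * a   ≡⟨ sym eq ⟩
  u + k * a   ≤⟨ +-monoʳ-≤ u (*-monoˡ-≤ a k≤l) ⟩
  u + l * a   ∎)
  where open ≤-Reasoning
... | no k≰l = ⊥-elim (<-irrefl refl (begin-strict
  v + l * a         <⟨ +-monoˡ-< (l * a) v<u+a ⟩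
  u + a + l * a     ≡⟨ +-assoc u a (l * a) ⟩
  u + suc l * a     ≤⟨ +-monoʳ-≤ u (*-monoˡ-≤ a (≰⇒> k≰l)) ⟩
  u + k * a         ≡⟨ eq ⟩
  v + l * a         ∎))
  where open ≤-Reasoning

m+n≡1⇒m≡0 : ∀ {m n} → m + n ≡ 1 → 1 ≤ n → m ≡ 0
m+n≡1⇒m≡0 {m} {n} eq 1≤n = n≤0⇒n≡0 (+-cancelʳ-≤ 1 m 0 (begin
  m + 1   ≤⟨ +-monoʳ-≤ m 1≤n ⟩
  m + n   ≡⟨ eq ⟩
  1       ∎))
  where open ≤-Reasoning

∈ᵇ⇒∈ : ∀ {n} {j : Fin n} ks → j ∈ᵇ ks ≡ true → j ∈ ks
∈ᵇ⇒∈ {j = j} (k ∷ ks) eq with j F.≟ k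
... | yes j≡k = here j≡k
... | no _    = there (∈ᵇ⇒∈ ks eq)

∉⇒∈ᵇ≡false : ∀ {n} {j : Fin n} ks → ¬ (j ∈ ks) → j ∈ᵇ ks ≡ false
∉⇒∈ᵇ≡false {j = j} ks j∉ks with j ∈ᵇ ks in eq
... | true  = ⊥-elim (j∉ks (∈ᵇ⇒∈ ks eq))
... | false = refl

⟦∈ᵇ-∷⟧ : ∀ {n} (j k : Fin n) ks → ¬ (k ∈ ks) →
         ⟦ j ∈ᵇ (k ∷ ks) ⟧ ≡ ⟦ ⌊ j F.≟ k ⌋ ⟧ + ⟦ j ∈ᵇ ks ⟧
⟦∈ᵇ-∷⟧ j k ks k∉ks with j F.≟ k
... | no _     = refl
... | yes refl = cong (λ b → 1 + ⟦ b ⟧) (sym (∉⇒∈ᵇ≡false ks k∉ks))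

∑-∈ᵇ : ∀ n (js : List (Fin n)) → Unique js → ∑ n (λ j → ⟦ j ∈ᵇ js ⟧) ≡ length js
∑-∈ᵇ n []       _                = ∑-zero n
∑-∈ᵇ n (k ∷ ks) (k≢ks ∷ unique) = begin
  ∑ n (λ j → ⟦ j ∈ᵇ (k ∷ ks) ⟧)
    ≡⟨ ∑-cong n (λ j → ⟦∈ᵇ-∷⟧ j k ks (All¬⇒¬Any k≢ks)) ⟩
  ∑ n (λ j → ⟦ ⌊ j F.≟ k ⌋ ⟧ + ⟦ j ∈ᵇ ks ⟧)
    ≡⟨ ∑-distrib-+ n _ _ ⟩
  ∑ n (λ j → ⟦ ⌊ j F.≟ k ⌋ ⟧) + ∑ n (λ j → ⟦ j ∈ᵇ ks ⟧)
    ≡⟨ cong₂ _+_ (∑-indicator n k) (∑-∈ᵇ n ks unique) ⟩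
  1 + length ks
    ∎
  where open ≡-Reasoning

overwrite-1 : ∀ (c : Bool) {u v : ℕ} → (c ≡ true → u ≡ 0) → v ≡ (if c then 1 else u) → v ≡ u + ⟦ c ⟧
overwrite-1 true  u≡0 refl = cong (_+ 1) (sym (u≡0 refl))
overwrite-1 false _   refl = sym (+-identityʳ _)

overwrite-0 : ∀ (c : Bool) {u v : ℕ} → (c ≡ true → u ≡ 1) → v ≡ (if c then 0 else u) → u ≡ v + ⟦ c ⟧
overwrite-0 true  u≡1 refl = u≡1 refl
overwrite-0 false _   refl = sym (+-identityʳ _)

module Procedure {n m : ℕ} (p : Fin n → ℕ) (T : Fin m → ℕ) (a : ℕ) where
  open Inst p T a

  infix 4 _≐_⊕_

  record _≐_⊕_ (z₁ z₀ δ : Asg n m) : Set where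
    constructor pointwise
    field entry : ∀ i j → z₁ i j ≡ z₀ i j + δ i j
  open _≐_⊕_

  col : Asg n m → Fin n → ℕ
  col z j = ∑ m (λ i → z i j)

  Balanced : Asg n m → Set
  Balanced z = (∀ i → Small i → load z i ≡ T i) × (∀ i → Big i → load z i ≈ T i mod a)

  Admissible : Asg n m → Set
  Admissible δ = (∀ i → Small i → load δ i ≡ 0) × (∀ i → Big i → a ∣ load δ i)

  -- π j counts the pending (removed, not yet reassigned) copies of job j
  Accounted : Asg n m → (Fin n → ℕ) → Set
  Accounted z π = ∀ j → col z j + π j ≡ 1

  Accounted-cong : ∀ {z π π′} → (∀ j → π j ≡ π′ j) → Accounted z π → Accounted z π′
  Accounted-cong π≗π′ acc j = trans (cong (_ +_) (sym (π≗π′ j))) (acc j)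

  load-⊕ : ∀ {z₁ z₀ δ} → z₁ ≐ z₀ ⊕ δ → ∀ i → load z₁ i ≡ load z₀ i + load δ i
  load-⊕ {z₁} {z₀} {δ} z₁≐ i = begin
    load z₁ i
      ≡⟨ ∑-cong n (λ j → trans (cong (p j *_) (entry z₁≐ i j)) (*-distribˡ-+ (p j) _ _)) ⟩
    ∑ n (λ j → p j * z₀ i j + p j * δ i j)   ≡⟨ ∑-distrib-+ n _ _ ⟩
    load z₀ i + load δ i                     ∎
    where open ≡-Reasoning

  col-⊕ : ∀ {z₁ z₀ δ} → z₁ ≐ z₀ ⊕ δ → ∀ j → col z₁ j ≡ col z₀ j + col δ j
  col-⊕ z₁≐ j = trans (∑-cong m (λ i → entry z₁≐ i j)) (∑-distrib-+ m _ _)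

  Balanced-⊕ : ∀ {z₁ z₀ δ} → z₁ ≐ z₀ ⊕ δ → Admissible δ → Balanced z₀ ⇔ Balanced z₁
  Balanced-⊕ {z₁} {z₀} {δ} z₁≐ (δ-small , δ-big) = mk⇔ to from
    where
    to : Balanced z₀ → Balanced z₁
    to (small , big) = small′ , big′
      where
      small′ : ∀ i → Small i → load z₁ i ≡ T i
      small′ i s = begin
        load z₁ i             ≡⟨ load-⊕ z₁≐ i ⟩
        load z₀ i + load δ i  ≡⟨ cong (load z₀ i +_) (δ-small i s) ⟩
        load z₀ i + 0         ≡⟨ +-identityʳ _ ⟩
        load z₀ i             ≡⟨ small i s ⟩
        T i                   ∎
        where open ≡-Reasoning
      big′ : ∀ i → Big i → load z₁ i ≈ T i mod a
      big′ i b = subst (_≈ T i mod a) (sym (load-⊕ z₁≐ i)) (≈mod-+ (big i b) (δ-big i b))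
    from : Balanced z₁ → Balanced z₀
    from (small , big) = small′ , big′
      where
      small′ : ∀ i → Small i → load z₀ i ≡ T i
      small′ i s = begin
        load z₀ i             ≡⟨ sym (+-identityʳ _) ⟩
        load z₀ i + 0         ≡⟨ cong (load z₀ i +_) (sym (δ-small i s)) ⟩
        load z₀ i + load δ i  ≡⟨ sym (load-⊕ z₁≐ i) ⟩
        load z₁ i             ≡⟨ small i s ⟩
        T i                   ∎
        where open ≡-Reasoning
      big′ : ∀ i → Big i → load z₀ i ≈ T i mod a
      big′ i b = ≈mod-cancel-+ (subst (_≈ T i mod a) (load-⊕ z₁≐ i) (big i b)) (δ-big i b)

  Accounted-⊕ : ∀ {z₁ z₀ δ π} → z₁ ≐ z₀ ⊕ δ → Accounted z₁ π → Accounted z₀ (λ j → col δ j + π j)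
  Accounted-⊕ {z₁} {z₀} {δ} {π} z₁≐ acc j = begin
    col z₀ j + (col δ j + π j)   ≡⟨ sym (+-assoc (col z₀ j) _ _) ⟩
    col z₀ j + col δ j + π j     ≡⟨ cong (_+ π j) (sym (col-⊕ z₁≐ j)) ⟩
    col z₁ j + π j               ≡⟨ acc j ⟩
    1                            ∎
    where open ≡-Reasoning

  single : Fin m → (Fin n → Bool) → Asg n m
  single i e i′ j = ⟦ ⌊ i′ F.≟ i ⌋ ∧ e j ⟧

  weight : (Fin n → Bool) → ℕ
  weight e = ∑ n (λ j → p j * ⟦ e j ⟧)

  col-single : ∀ i e j → col (single i e) j ≡ ⟦ e j ⟧
  col-single i e j with e j
  ... | true  = trans (∑-cong m (λ i′ → cong ⟦_⟧ (∧-identityʳ _))) (∑-indicator m i)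
  ... | false = trans (∑-cong m (λ i′ → cong ⟦_⟧ (∧-zeroʳ _))) (∑-zero m)

  single-admissible : ∀ {i e} → Big i → a ∣ weight e → Admissible (single i e)
  single-admissible {i} {e} big a∣weight = small , big′
    where
    row-zero : ∑ n (λ j → p j * 0) ≡ 0
    row-zero = trans (∑-cong n (λ j → *-zeroʳ (p j))) (∑-zero n)
    small : ∀ i′ → Small i′ → load (single i e) i′ ≡ 0
    small i′ s with i′ F.≟ i
    ... | yes refl = ⊥-elim (<⇒≱ s big)
    ... | no _     = row-zero
    big′ : ∀ i′ → Big i′ → a ∣ load (single i e) i′
    big′ i′ _ with i′ F.≟ i
    ... | yes refl = a∣weight
    ... | no _     = subst (a ∣_) (sym row-zero) (a ∣0)

  place : ∀ {z z′ π i} e → Big i → a ∣ weight e → (∀ j → ⟦ e j ⟧ ≤ π j) → Accounted z π →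
          (∀ i′ j → z′ i′ j ≡ (if ⌊ i′ F.≟ i ⌋ ∧ e j then 1 else z i′ j)) →
          (Balanced z → Balanced z′) × Accounted z′ (λ j → π j ∸ ⟦ e j ⟧)
  place {z} {z′} {π} {i} e big a∣weight pending acc overwrite =
    Equivalence.to (Balanced-⊕ z′≐ (single-admissible big a∣weight)) , acc′
    where
    off-machines : ∀ j → e j ≡ true → col z j ≡ 0
    off-machines j selected = m+n≡1⇒m≡0 (acc j) (subst (λ b → ⟦ b ⟧ ≤ π j) selected (pending j))
    unassigned : ∀ i′ j → ⌊ i′ F.≟ i ⌋ ∧ e j ≡ true → z i′ j ≡ 0
    unassigned i′ j selected with i′ F.≟ i
    ... | yes refl = n≤0⇒n≡0 (subst (z i′ j ≤_) (off-machines j selected) (≤-∑ m (λ i → z i j) i′))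
    z′≐ : z′ ≐ z ⊕ single i e
    z′≐ = pointwise (λ i′ j → overwrite-1 (⌊ i′ F.≟ i ⌋ ∧ e j) (unassigned i′ j) (overwrite i′ j))
    acc′ : Accounted z′ (λ j → π j ∸ ⟦ e j ⟧)
    acc′ j = begin
      col z′ j + (π j ∸ ⟦ e j ⟧)           ≡⟨ cong (_+ (π j ∸ ⟦ e j ⟧)) (col-⊕ z′≐ j) ⟩
      col z j + col (single i e) j + (π j ∸ ⟦ e j ⟧)
                                             ≡⟨ cong (λ c → col z j + c + (π j ∸ ⟦ e j ⟧)) (col-single i e j) ⟩
      col z j + ⟦ e j ⟧ + (π j ∸ ⟦ e j ⟧)  ≡⟨ +-assoc (col z j) _ _ ⟩
      col z j + (⟦ e j ⟧ + (π j ∸ ⟦ e j ⟧)) ≡⟨ cong (col z j +_) (m+[n∸m]≡n (pending j)) ⟩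
      col z j + π j                          ≡⟨ acc j ⟩
      1                                      ∎
      where open ≡-Reasoning

  DivisibleBundle : Bundle n → Set
  DivisibleBundle js = a ∣ weight (_∈ᵇ js)

  bundleStep-removes : ∀ {z js z′} → BundleStep z js z′ →
    Σ (Fin m) λ i → Big i × DivisibleBundle js × z ≐ z′ ⊕ single i (_∈ᵇ js)
  bundleStep-removes {z} {js} {z′} (i , b , big , _ , length≡a , unique , members , overwrite) =
    i , big , divides b weight≡b*a , pointwise (λ i′ j → overwrite-0 _ (on-i i′ j) (overwrite i′ j))
    where
    on-i : ∀ i′ j → ⌊ i′ F.≟ i ⌋ ∧ (j ∈ᵇ js) ≡ true → z i′ j ≡ 1
    on-i i′ j selected with i′ F.≟ i
    ... | yes refl = proj₂ (All-lookup members (∈ᵇ⇒∈ js selected))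
    member-time : ∀ j → p j * ⟦ j ∈ᵇ js ⟧ ≡ b * ⟦ j ∈ᵇ js ⟧
    member-time j with j ∈ᵇ js in j∈ᵇjs
    ... | true  = cong (_* 1) (proj₁ (All-lookup members (∈ᵇ⇒∈ js j∈ᵇjs)))
    ... | false = trans (*-zeroʳ (p j)) (sym (*-zeroʳ b))
    weight≡b*a : weight (_∈ᵇ js) ≡ b * a
    weight≡b*a = begin
      weight (_∈ᵇ js)                 ≡⟨ ∑-cong n member-time ⟩
      ∑ n (λ j → b * ⟦ j ∈ᵇ js ⟧)    ≡⟨ sym (*-distribˡ-∑ n b _) ⟩
      b * ∑ n (λ j → ⟦ j ∈ᵇ js ⟧)    ≡⟨ cong (b *_) (trans (∑-∈ᵇ n js unique) length≡a) ⟩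
      b * a                           ∎
      where open ≡-Reasoning

  inBundles : List (Bundle n) → Fin n → ℕ
  inBundles bs j = sum (map (λ js → ⟦ j ∈ᵇ js ⟧) bs)

  inBundles-↭ : ∀ {bs bs′} → bs ↭ bs′ → ∀ j → inBundles bs j ≡ inBundles bs′ j
  inBundles-↭ bs↭bs′ j = sum-↭ (map⁺ _ bs↭bs′)

  bundleLoop-divisible : ∀ {z bs z′} → BundleLoop z bs z′ → All DivisibleBundle bs
  bundleLoop-divisible stop = []
  bundleLoop-divisible (step st rest) =
    let (_ , _ , divisible , _) = bundleStep-removes st
    in divisible ∷ bundleLoop-divisible rest

  bundleLoop-balanced : ∀ {z bs z′} → BundleLoop z bs z′ → Balanced z → Balanced z′
  bundleLoop-balanced stop bal = bal
  bundleLoop-balanced (step st rest) bal =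
    let (_ , big , divisible , z≐) = bundleStep-removes st
    in bundleLoop-balanced rest (Equivalence.from (Balanced-⊕ z≐ (single-admissible big divisible)) bal)

  bundleLoop-accounted : ∀ {z bs z′ π} → BundleLoop z bs z′ → Accounted z π →
                         Accounted z′ (λ j → inBundles bs j + π j)
  bundleLoop-accounted stop acc = acc
  bundleLoop-accounted {π = π} (step {js = js} {bs = bs} st rest) acc =
    let (i , _ , _ , z≐) = bundleStep-removes st
        acc′ = Accounted-cong (λ j → cong (_+ π j) (col-single i (_∈ᵇ js) j)) (Accounted-⊕ z≐ acc)
    in Accounted-cong (λ j → x∙yz≈yx∙z (inBundles bs j) ⟦ j ∈ᵇ js ⟧ (π j))
                      (bundleLoop-accounted rest acc′)

  phaseII-invariant : ∀ {z bs z′ π} → PhaseII z bs z′ → All DivisibleBundle bs → Balanced z →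
                      Accounted z (λ j → inBundles bs j + π j) → Balanced z′ × Accounted z′ π
  phaseII-invariant stop _ bal acc = bal , acc
  phaseII-invariant {π = π} (step {js = js} {bs = bs} i big overwrite _ rest) (divisible ∷ divisibles)
                    bal acc =
    let (balanced , acc′) = place (_∈ᵇ js) big divisible pending acc overwrite
    in phaseII-invariant rest divisibles (balanced bal) (Accounted-cong remaining acc′)
    where
    pending : ∀ j → ⟦ j ∈ᵇ js ⟧ ≤ ⟦ j ∈ᵇ js ⟧ + inBundles bs j + π j
    pending j = ≤-trans (m≤m+n _ _) (m≤m+n _ _)
    remaining : ∀ j → ⟦ j ∈ᵇ js ⟧ + inBundles bs j + π j ∸ ⟦ j ∈ᵇ js ⟧ ≡ inBundles bs j + π j
    remaining j = trans (cong (_∸ ⟦ j ∈ᵇ js ⟧) (+-assoc ⟦ j ∈ᵇ js ⟧ _ _)) (m+n∸m≡n ⟦ j ∈ᵇ js ⟧ _)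

  phaseIII-invariant : ∀ {x z done z′ r} → PhaseIII x z done z′ → (∀ j → RemovedA x j → 1 ≤ r j) →
                       Balanced z → Accounted z r →
                       Balanced z′ × Accounted z′ (λ j → r j ∸ ⟦ j ∈ᵇ done ⟧)
  phaseIII-invariant start _ bal acc = bal , acc
  phaseIII-invariant {r = r} (step {done = done} j i rest removed j∉done big overwrite _) r≥1 bal acc =
    let (bal′ , acc′)        = phaseIII-invariant rest r≥1 bal acc
        (balanced , acc″)   = place (λ j′ → ⌊ j′ F.≟ j ⌋) big (divides 1 weight≡a) pending acc′ overwrite
    in balanced bal′ , Accounted-cong remaining acc″
    where
    weight≡a : weight (λ j′ → ⌊ j′ F.≟ j ⌋) ≡ 1 * a
    weight≡a = trans (∑-pick n p j) (trans (proj₁ removed) (sym (*-identityˡ a)))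
    pending : ∀ j′ → ⟦ ⌊ j′ F.≟ j ⌋ ⟧ ≤ r j′ ∸ ⟦ j′ ∈ᵇ done ⟧
    pending j′ with j′ F.≟ j
    ... | yes refl = subst (λ b → 1 ≤ r j′ ∸ ⟦ b ⟧) (sym (∉⇒∈ᵇ≡false done j∉done)) (r≥1 j′ removed)
    ... | no _     = z≤n
    remaining : ∀ j′ → r j′ ∸ ⟦ j′ ∈ᵇ done ⟧ ∸ ⟦ ⌊ j′ F.≟ j ⌋ ⟧ ≡ r j′ ∸ ⟦ j′ ∈ᵇ (j ∷ done) ⟧
    remaining j′ = begin
      r j′ ∸ ⟦ j′ ∈ᵇ done ⟧ ∸ ⟦ ⌊ j′ F.≟ j ⌋ ⟧     ≡⟨ ∸-+-assoc (r j′) ⟦ j′ ∈ᵇ done ⟧ ⟦ ⌊ j′ F.≟ j ⌋ ⟧ ⟩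
      r j′ ∸ (⟦ j′ ∈ᵇ done ⟧ + ⟦ ⌊ j′ F.≟ j ⌋ ⟧)   ≡⟨ cong (r j′ ∸_) (+-comm ⟦ j′ ∈ᵇ done ⟧ _) ⟩
      r j′ ∸ (⟦ ⌊ j′ F.≟ j ⌋ ⟧ + ⟦ j′ ∈ᵇ done ⟧)   ≡⟨ cong (r j′ ∸_) (sym (⟦∈ᵇ-∷⟧ j′ j done j∉done)) ⟩
      r j′ ∸ ⟦ j′ ∈ᵇ (j ∷ done) ⟧                   ∎
      where open ≡-Reasoning

  Big⇒big? : ∀ {i} → Big i → big? i ≡ true
  Big⇒big? {i} big with pmax ^ 4 ≤? T i
  ... | yes _    = refl
  ... | no ¬big  = ⊥-elim (¬big big)

  Small⇒big? : ∀ {i} → Small i → big? i ≡ false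
  Small⇒big? {i} small with pmax ^ 4 ≤? T i
  ... | yes big = ⊥-elim (<⇒≱ small big)
  ... | no _    = refl

  takenOff : Asg n m → Asg n m
  takenOff x i j = if big? i ∧ ⌊ p j N.≟ a ⌋ then x i j else 0

  initRemove-⊕ : ∀ x → x ≐ initRemove x ⊕ takenOff x
  initRemove-⊕ x = pointwise split
    where
    split : ∀ i j → x i j ≡ initRemove x i j + takenOff x i j
    split i j with big? i ∧ ⌊ p j N.≟ a ⌋
    ... | true  = refl
    ... | false = sym (+-identityʳ _)

  takenOff-admissible : ∀ x → Admissible (takenOff x)
  takenOff-admissible x = small , big
    where
    small : ∀ i → Small i → load (takenOff x) i ≡ 0
    small i s rewrite Small⇒big? s = trans (∑-cong n (λ j → *-zeroʳ (p j))) (∑-zero n)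
    time-a : ∀ i j → p j * (if ⌊ p j N.≟ a ⌋ then x i j else 0)
                   ≡ a * (if ⌊ p j N.≟ a ⌋ then x i j else 0)
    time-a i j with p j N.≟ a
    ... | yes pj≡a = cong (_* x i j) pj≡a
    ... | no _     = trans (*-zeroʳ (p j)) (sym (*-zeroʳ a))
    big : ∀ i → Big i → a ∣ load (takenOff x) i
    big i b rewrite Big⇒big? b =
      subst (a ∣_) (sym (trans (∑-cong n (time-a i)) (sym (*-distribˡ-∑ n a _)))) (m∣m*n _)

  takenOff-RemovedA : ∀ x j → RemovedA x j → 1 ≤ col (takenOff x) j
  takenOff-RemovedA x j (pj≡a , i , big , xij≡1) =
    ≤-trans (≤-reflexive (sym taken)) (≤-∑ m (λ i → takenOff x i j) i)
    where
    taken : takenOff x i j ≡ 1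
    taken rewrite Big⇒big? big with p j N.≟ a
    ... | yes _    = xij≡1
    ... | no pj≢a  = ⊥-elim (pj≢a pj≡a)

  phaseI-invariant : ∀ {x bs z} → ModIPFeasible x → PhaseI x bs z →
    Balanced z × Accounted z (λ j → inBundles bs j + col (takenOff x) j) × All DivisibleBundle bs
  phaseI-invariant {x} (_ , small , big , _ , assigned) (loop , _) =
    bundleLoop-balanced loop (Equivalence.from (Balanced-⊕ (initRemove-⊕ x) (takenOff-admissible x)) bal) ,
    bundleLoop-accounted loop (Accounted-cong (λ j → +-identityʳ _) (Accounted-⊕ (initRemove-⊕ x) acc)) ,
    bundleLoop-divisible loop
    where
    bal : Balanced x
    bal = small , λ i b → ∣∣-∣⇒≈mod (load x i) (T i) (big i b)
    acc : Accounted x (λ _ → 0)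
    acc j = trans (+-identityʳ _) (assigned j)

  ∑-load : ∀ z → ∑ m (load z) ≡ ∑ n (λ j → p j * col z j)
  ∑-load z = begin
    ∑ m (λ i → ∑ n (λ j → p j * z i j))   ≡⟨ ∑-comm m n _ ⟩
    ∑ n (λ j → ∑ m (λ i → p j * z i j))   ≡⟨ ∑-cong n (λ j → sym (*-distribˡ-∑ m (p j) _)) ⟩
    ∑ n (λ j → p j * col z j)              ∎
    where open ≡-Reasoning

  fits-somewhere : ∀ {z π} → ∑ n p ≡ ∑ m T → 1 ≤ a → Balanced z → Accounted z π →
                   ∀ j₀ → p j₀ ≡ a → 1 ≤ π j₀ → Σ (Fin m) λ i → Big i × load z i + a ≤ T i
  fits-somewhere {z} {π} total 1≤a (small , big) acc j₀ pj₀≡a pending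
    with any? (λ i → (pmax ^ 4 ≤? T i) ×-dec (load z i + a ≤? T i))
  ... | yes found = found
  ... | no none   = ⊥-elim (<-irrefl refl (<-≤-trans (m<m+n (∑ m T) 1≤a) overfull))
    where
    full : ∀ i → T i ≤ load z i
    full i with pmax ^ 4 ≤? T i
    ... | yes b  = ≈mod⇒≤ (big i b) (≰⇒> (λ fits → none (i , b , fits)))
    ... | no ¬b  = ≤-reflexive (sym (small i (≰⇒> ¬b)))
    col≤1 : ∀ j → p j * col z j ≤ p j
    col≤1 j = ≤-trans (*-monoʳ-≤ (p j) (subst (col z j ≤_) (acc j) (m≤m+n _ _)))
                      (≤-reflexive (*-identityʳ (p j)))
    j₀-free : p j₀ * col z j₀ + a ≤ p j₀
    j₀-free = ≤-reflexive (begin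
      p j₀ * col z j₀ + a   ≡⟨ cong (λ c → p j₀ * c + a) (m+n≡1⇒m≡0 (acc j₀) pending) ⟩
      p j₀ * 0 + a          ≡⟨ cong (_+ a) (*-zeroʳ (p j₀)) ⟩
      a                     ≡⟨ sym pj₀≡a ⟩
      p j₀                  ∎)
      where open ≡-Reasoning
    overfull : ∑ m T + a ≤ ∑ m T
    overfull = begin
      ∑ m T + a                        ≤⟨ +-monoˡ-≤ a (∑-mono-≤ m full) ⟩
      ∑ m (load z) + a                 ≡⟨ cong (_+ a) (∑-load z) ⟩
      ∑ n (λ j → p j * col z j) + a    ≤⟨ ∑-mono-≤-slack n j₀ a col≤1 j₀-free ⟩
      ∑ n p                            ≡⟨ total ⟩
      ∑ m T                            ∎
      where open ≤-Reasoning

lemma2 : (n m : ℕ) → n ≥ m → m ≥ 1 →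
    (p : Fin n → ℕ) (T : Fin m → ℕ) → ∑ n p ≡ ∑ m T →
    (a : ℕ) → Σ (Fin n) (λ j → p j ≡ a) →
    (x : Asg n m) → Inst.ModIPFeasible p T a x →
    (bs : List (Bundle n)) (z₁ : Asg n m) → Inst.PhaseI p T a x bs z₁ →
    (order : List (Bundle n)) → order ↭ bs →
    (z₂ : Asg n m) → Inst.PhaseII p T a z₁ order z₂ →
    (done : List (Fin n)) (z : Asg n m) → Inst.PhaseIII p T a x z₂ done z →
    Σ (Fin n) (λ j → Inst.RemovedA p T a x j × ¬ (j ∈ done)) →
    Σ (Fin m) (λ i → Inst.Big p T a i × Inst.load p T a z i + a ≤ T i)
lemma2 n m _ _ p T total a _ x feasible bs z₁ phaseI order order↭bs z₂ phaseII done z phaseIII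
       (j₀ , removed@(pj₀≡a , i₀ , big₀ , _) , j₀∉done) =
  let (bal₁ , acc₁ , divisible) = phaseI-invariant feasible phaseI
      (bal₂ , acc₂) = phaseII-invariant phaseII (All-resp-↭ (↭-sym order↭bs) divisible) bal₁
                        (Accounted-cong (λ j → cong (_+ r j) (sym (inBundles-↭ order↭bs j))) acc₁)
      (bal₃ , acc₃) = phaseIII-invariant phaseIII (takenOff-RemovedA x) bal₂ acc₂
  in fits-somewhere total 1≤a bal₃ acc₃ j₀ pj₀≡a pending
  where
  open Procedure p T a
  r : Fin n → ℕ
  r = col (takenOff x)
  pending : 1 ≤ r j₀ ∸ ⟦ j₀ ∈ᵇ done ⟧
  pending = subst (λ b → 1 ≤ r j₀ ∸ ⟦ b ⟧) (sym (∉⇒∈ᵇ≡false done j₀∉done)) (takenOff-RemovedA x j₀ removed)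
  -- LoopDone at b = a + 1 says fewer than a such jobs sit on i₀, so a > 0
  1≤a : 1 ≤ a
  1≤a = ≤-trans (s≤s z≤n) (proj₂ phaseI i₀ big₀ (suc a) 1+n≢n)
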